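{- For any $r$, the class $\Theta_{n}$ is admissible in the Lyubeznik resolution $\mathcal{L}_{n,r}$.
   Context: Let $k$ be a commutative ring with unity. Vertices of $Q_n$ are identified with $[2^n]$ via binary expansion; $d_H$ is Hamming distance. The Stanley--Reisner ideal of $VR(Q_n;r)$ in $k[x_0,\ldots,x_{2^n-1}]$ is generated by $x_ax_b$ with $a<b$, $d_H(a,b)>r$; these generators are ordered first by $d_H(a,b)$ and then lexicographically, giving $m_1<m_2<\cdots$. The Taylor complex is $k[x_0,\ldots,x_{2^n-1}]\otimes\Lambda(e_1,e_2,\ldots)$, with $e_i$ (also written $e_{(a,b)}$) corresponding to $m_i=x_ax_b$. For $i_1<\cdots<i_t$, $e_{i_1}\cdots e_{i_t}$ is admissible if for every $h$ and every $q>i_h$, $m_q$ does not divide $\operatorname{lcm}(m_{i_1},\ldots,m_{i_h})$. The Lyubeznik resolution is the subcomplex of the Taylor resolution generated by admissible elements, and $\mathcal{L}_{n,r}$ denotes it tensored with $k$ over $k[x_0,\ldots,x_{2^n-1}]$. Define $\Theta_n=\prod_{0\le i<j<2^n,\ i+j=2^n-1} e_{(i,j)}=\prod_{i=0}^{2^{n-1}-1}e_{(i,\overline{i})}$, where $\overline{i}$ is the antipodal vertex (bitwise complement), so each factor has $d_H=n$. -}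

module Defs where

open import Data.Nat using (ℕ; zero; suc; _+_; _∸_; _^_; _<_; _%_; _/_; _≡ᵇ_; ⌊_/2⌋)
open import Data.Bool using (if_then_else_)
open import Data.Product using (_×_; _,_; proj₁; proj₂)
open import Data.Sum using (_⊎_)
open import Data.List using (List; []; _∷_; map; upTo; take; length; lookup; concatMap)
open import Data.List.Membership.Propositional using (_∈_)
open import Data.List.Relation.Unary.All using (All)
open import Data.List.Relation.Unary.Linked using (Linked)
open import Data.Fin using (Fin; toℕ)
open import Relation.Binary.PropositionalEquality using (_≡_)
open import Relation.Nullary using (¬_)

-- Vertices of Q_n are natural numbers a < 2^n (binary expansion, n bits).
-- Hamming distance of the n-bit binary expansions of a and b.
dH : ℕ → ℕ → ℕ → ℕ
dH zero    a b = 0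
dH (suc n) a b = (if (a % 2) ≡ᵇ (b % 2) then 0 else 1) + dH n (a / 2) (b / 2)

-- A generator x_a x_b of the Stanley–Reisner ideal of VR(Q_n; r) is
-- represented by the pair (a , b).
Pair : Set
Pair = ℕ × ℕ

IsGen : ℕ → ℕ → Pair → Set
IsGen n r (a , b) = a < b × b < 2 ^ n × r < dH n a b

LexLt : Pair → Pair → Set
LexLt (a , b) (a' , b') = a < a' ⊎ (a ≡ a' × b < b')

_≺[_]_ : Pair → ℕ → Pair → Set
(a , b) ≺[ n ] (a' , b') =
  dH n a b < dH n a' b' ⊎ (dH n a b ≡ dH n a' b' × LexLt (a , b) (a' , b'))

vars : List Pair → List ℕ
vars = concatMap (λ p → proj₁ p ∷ proj₂ p ∷ [])

-- m_q = x_a x_b divides lcm of the squarefree monomials in S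
-- iff both x_a and x_b occur in one of them.
DividesLcm : Pair → List Pair → Set
DividesLcm (a , b) S = a ∈ vars S × b ∈ vars S

-- A basis element e_{i_1} ⋯ e_{i_t} (i_1 < ⋯ < i_t) of the Taylor complex,
-- given as the list of its generators m_{i_1}, …, m_{i_t} in increasing order,
-- is admissible if for every h and every generator m_q > m_{i_h},
-- m_q does not divide lcm(m_{i_1}, …, m_{i_h}).
Admissible : ℕ → ℕ → List Pair → Set
Admissible n r S =
  All (IsGen n r) S ×
  Linked (λ p q → p ≺[ n ] q) S ×
  ((h : Fin (length S)) (q : Pair) → IsGen n r q → lookup S h ≺[ n ] q →
     ¬ DividesLcm q (take (suc (toℕ h)) S))

Theta : ℕ → List Pair
Theta n = map (λ i → (i , (2 ^ n ∸ 1) ∸ i)) (upTo ⌊ 2 ^ n /2⌋)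

module Submission where

-- The factors (i, ī) of Θ_n are the antipodal pairs a + b + 1 = 2^n, and these are exactly
-- the pairs at the maximal Hamming distance n, since a + b + 1 = 2^n forces every bit of a
-- and b to differ. So all factors share the top distance and are ordered by their first
-- vertex, and a generator x_a x_b above the factor (j, j̄) must again be antipodal, with
-- j < a < b = ā. Then x_a divides no earlier factor x_i x_ī (i ≤ j): a = i is too large,
-- and a = ī would give ā ≤ ī = a, as the antipode reverses order and i < a.

open import Defs
open import Data.Nat using (ℕ; zero; suc; _+_; _*_; _∸_; _^_; _≤_; _<_; _%_; _/_; _⊓_; _≡ᵇ_; ⌊_/2⌋; z≤n; s≤s; z<s; s<s)
open import Data.Nat.Properties
open import Data.Nat.DivMod using (m%n<n; m≡m%n+[m/n]*n; m<n*o⇒m/o<n)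
open import Data.Nat.Tactic.RingSolver using (solve-∀)
open import Data.Bool using (true; false; if_then_else_)
open import Data.Product using (_×_; _,_; ∃-syntax)
open import Data.Product.Function.NonDependent.Propositional using (_×-⇔_)
open import Data.Sum using (_⊎_; inj₁; inj₂)
open import Data.Empty using (⊥-elim)
open import Data.Fin using (Fin; toℕ)
open import Data.Fin.Properties using (toℕ<n)
open import Data.List using (List; []; _∷_; length; take; lookup; applyUpTo)
open import Data.List.Properties using (map-upTo; lookup-applyUpTo; length-applyUpTo)
open import Data.List.Relation.Unary.Any using (here; there)
import Data.List.Relation.Unary.Any.Properties as Any
import Data.List.Relation.Unary.All.Properties as All
import Data.List.Relation.Unary.Linked.Properties as Linked
open import Data.List.Membership.Propositional using (_∈_; _∉_)
open import Data.List.Membership.Propositional.Properties using (∈-concatMap⁻)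
open import Function.Bundles using (_⇔_; mk⇔; module Equivalence)
open import Function.Related.Propositional using (module EquationalReasoning; K-refl; SK-sym)
open import Relation.Binary.PropositionalEquality
open import Relation.Nullary using (¬_)

dH≤n : ∀ n a b → dH n a b ≤ n
dH≤n zero    a b = z≤n
dH≤n (suc n) a b with a % 2 ≡ᵇ b % 2
... | true  = m≤n⇒m≤1+n (dH≤n n (a / 2) (b / 2))
... | false = s≤s (dH≤n n (a / 2) (b / 2))

private
  even+even : ∀ A B → A * 2 + B * 2 ≡ 2 * (A + B)
  even+even = solve-∀

  odd+odd : ∀ A B → suc (suc (A * 2) + suc (B * 2)) ≡ suc (2 * suc (A + B))
  odd+odd = solve-∀

  even+odd : ∀ A B → suc (A * 2 + suc (B * 2)) ≡ 2 * suc (A + B)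
  even+odd = solve-∀

  odd+even : ∀ A B → suc (suc (A * 2) + B * 2) ≡ 2 * suc (A + B)
  odd+even = solve-∀

  halve-≡ : ∀ {k m} c → c ≡ 2 * k → c ≡ 2 * m ⇔ (1 ≡ 1 × k ≡ m)
  halve-≡ {k} {m} c c≡2k =
    mk⇔ (λ c≡2m → refl , *-cancelˡ-≡ k m 2 (trans (sym c≡2k) c≡2m))
        (λ (_ , k≡m) → trans c≡2k (cong (2 *_) k≡m))

bitSum≡2*m⇔ : ∀ {x y A B m} → x < 2 → y < 2 →
          suc ((x + A * 2) + (y + B * 2)) ≡ 2 * m ⇔ (x + y ≡ 1 × suc (A + B) ≡ m)
bitSum≡2*m⇔ {A = A} {B} {m} z<s z<s =
  mk⇔ (λ e → ⊥-elim (even≢odd m (A + B) (sym (trans (cong suc (sym (even+even A B))) e))))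
      (λ { (() , _) })
bitSum≡2*m⇔ {A = A} {B} {m} (s<s z<s) (s<s z<s) =
  mk⇔ (λ e → ⊥-elim (even≢odd m (suc (A + B)) (sym (trans (sym (odd+odd A B)) e))))
      (λ { (() , _) })
bitSum≡2*m⇔ {A = A} {B} z<s       (s<s z<s) = halve-≡ _ (even+odd A B)
bitSum≡2*m⇔ {A = A} {B} (s<s z<s) z<s       = halve-≡ _ (odd+even A B)

differentBits⇔ : ∀ {x y d n} → x < 2 → y < 2 → d ≤ n →
                 (if x ≡ᵇ y then 0 else 1) + d ≡ suc n ⇔ (x + y ≡ 1 × d ≡ n)
differentBits⇔ z<s z<s d≤n =
  mk⇔ (λ d≡1+n → ⊥-elim (1+n≰n (subst (_≤ _) d≡1+n d≤n))) (λ { (() , _) })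
differentBits⇔ (s<s z<s) (s<s z<s) d≤n =
  mk⇔ (λ d≡1+n → ⊥-elim (1+n≰n (subst (_≤ _) d≡1+n d≤n))) (λ { (() , _) })
differentBits⇔ z<s (s<s z<s) _ = mk⇔ (λ e → refl , suc-injective e) (λ (_ , e) → cong suc e)
differentBits⇔ (s<s z<s) z<s _ = mk⇔ (λ e → refl , suc-injective e) (λ (_ , e) → cong suc e)

suc[a+b]≡2*m⇔ : ∀ m a b →
                suc (a + b) ≡ 2 * m ⇔ (a % 2 + b % 2 ≡ 1 × suc (a / 2 + b / 2) ≡ m)
suc[a+b]≡2*m⇔ m a b =
  subst₂ (λ a′ b′ → suc (a′ + b′) ≡ 2 * m ⇔ (a % 2 + b % 2 ≡ 1 × suc (a / 2 + b / 2) ≡ m))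
         (sym (m≡m%n+[m/n]*n a 2)) (sym (m≡m%n+[m/n]*n b 2))
         (bitSum≡2*m⇔ {A = a / 2} {B = b / 2} (m%n<n a 2) (m%n<n b 2))

m<2^[1+n]⇒m/2<2^n : ∀ n {a} → a < 2 ^ suc n → a / 2 < 2 ^ n
m<2^[1+n]⇒m/2<2^n n {a} a<2^[1+n] = m<n*o⇒m/o<n (subst (a <_) (*-comm 2 (2 ^ n)) a<2^[1+n])

antipodal⇔dH≡n : ∀ n {a b} → a < 2 ^ n → b < 2 ^ n → suc (a + b) ≡ 2 ^ n ⇔ dH n a b ≡ n
antipodal⇔dH≡n zero    z<s z<s = mk⇔ (λ _ → refl) (λ _ → refl)
antipodal⇔dH≡n (suc n) {a} {b} a<2^[1+n] b<2^[1+n] = begin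
  suc (a + b) ≡ 2 ^ suc n
    ∼⟨ suc[a+b]≡2*m⇔ (2 ^ n) a b ⟩
  (a % 2 + b % 2 ≡ 1 × suc (a / 2 + b / 2) ≡ 2 ^ n)
    ∼⟨ K-refl ×-⇔ antipodal⇔dH≡n n (m<2^[1+n]⇒m/2<2^n n a<2^[1+n]) (m<2^[1+n]⇒m/2<2^n n b<2^[1+n]) ⟩
  (a % 2 + b % 2 ≡ 1 × dH n (a / 2) (b / 2) ≡ n)
    ∼⟨ SK-sym (differentBits⇔ (m%n<n a 2) (m%n<n b 2) (dH≤n n _ _)) ⟩
  dH (suc n) a b ≡ suc n
    ∎
  where open EquationalReasoning

antipode : ℕ → ℕ → ℕ
antipode n i = 2 ^ n ∸ 1 ∸ i

antipodalPair : ℕ → ℕ → Pair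
antipodalPair n i = i , antipode n i

antipode≡2^n∸1+i : ∀ n i → antipode n i ≡ 2 ^ n ∸ suc i
antipode≡2^n∸1+i n i = ∸-+-assoc (2 ^ n) 1 i

antipode<2^n : ∀ n i → antipode n i < 2 ^ n
antipode<2^n n i = ≤-<-trans (m∸n≤m (2 ^ n ∸ 1) i) (∸-monoʳ-< {o = 0} z<s (m^n>0 2 n))

dH-antipode : ∀ n {i} → i < 2 ^ n → dH n i (antipode n i) ≡ n
dH-antipode n {i} i<2^n =
  Equivalence.to (antipodal⇔dH≡n n i<2^n (antipode<2^n n i)) (begin
    suc (i + antipode n i)    ≡⟨ cong (λ k → suc (i + k)) (antipode≡2^n∸1+i n i) ⟩
    suc i + (2 ^ n ∸ suc i)   ≡⟨ m+[n∸m]≡n i<2^n ⟩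
    2 ^ n                     ∎)
  where open ≡-Reasoning

dH≡n⇒antipode : ∀ n {a b} → a < 2 ^ n → b < 2 ^ n → dH n a b ≡ n → b ≡ antipode n a
dH≡n⇒antipode n {a} {b} a<2^n b<2^n dH≡n = begin
  b                   ≡⟨ m+n∸m≡n (suc a) b ⟨
  suc a + b ∸ suc a   ≡⟨ cong (_∸ suc a) (Equivalence.from (antipodal⇔dH≡n n a<2^n b<2^n) dH≡n) ⟩
  2 ^ n ∸ suc a       ≡⟨ antipode≡2^n∸1+i n a ⟨
  antipode n a        ∎
  where open ≡-Reasoning

m<⌊n/2⌋⇒[1+m]+[1+m]≤n : ∀ {m n} → m < ⌊ n /2⌋ → suc m + suc m ≤ n
m<⌊n/2⌋⇒[1+m]+[1+m]≤n {n = n} m<⌊n/2⌋ =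
  subst (_ ≤_) (⌊n/2⌋+⌈n/2⌉≡n n) (+-mono-≤ m<⌊n/2⌋ (≤-trans m<⌊n/2⌋ (⌊n/2⌋≤⌈n/2⌉ n)))

<⌊2^n/2⌋⇒<2^n : ∀ n {i} → i < ⌊ 2 ^ n /2⌋ → i < 2 ^ n
<⌊2^n/2⌋⇒<2^n n i<⌊2^n/2⌋ = m+n≤o⇒m≤o _ (m<⌊n/2⌋⇒[1+m]+[1+m]≤n i<⌊2^n/2⌋)

<⌊2^n/2⌋⇒<antipode : ∀ n {i} → i < ⌊ 2 ^ n /2⌋ → i < antipode n i
<⌊2^n/2⌋⇒<antipode n {i} i<⌊2^n/2⌋ =
  subst (i <_) (sym (antipode≡2^n∸1+i n i)) (m+n≤o⇒m≤o∸n (suc i) (m<⌊n/2⌋⇒[1+m]+[1+m]≤n i<⌊2^n/2⌋))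

antipodalPair-isGen : ∀ {n r i} → r < n → i < ⌊ 2 ^ n /2⌋ → IsGen n r (antipodalPair n i)
antipodalPair-isGen {n} {r} {i} r<n i<⌊2^n/2⌋ =
    <⌊2^n/2⌋⇒<antipode n i<⌊2^n/2⌋
  , antipode<2^n n i
  , subst (r <_) (sym (dH-antipode n (<⌊2^n/2⌋⇒<2^n n i<⌊2^n/2⌋))) r<n

antipodalPair-≺ : ∀ n {i j} → i < j → j < 2 ^ n → antipodalPair n i ≺[ n ] antipodalPair n j
antipodalPair-≺ n i<j j<2^n =
  inj₂ (trans (dH-antipode n (<-trans i<j j<2^n)) (sym (dH-antipode n j<2^n)) , inj₁ i<j)

antipodalPair-≺⇒ : ∀ n {j a b} → j < 2 ^ n → a < b → b < 2 ^ n →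
                   antipodalPair n j ≺[ n ] (a , b) → j < a × b ≡ antipode n a
antipodalPair-≺⇒ n j<2^n a<b b<2^n (inj₁ n<dH) =
  ⊥-elim (<⇒≱ (subst (_< _) (dH-antipode n j<2^n) n<dH) (dH≤n n _ _))
antipodalPair-≺⇒ n {j} {a} {b} j<2^n a<b b<2^n (inj₂ (dH≡ , lex)) = lexLt⇒ lex
  where
  b≡antipode : b ≡ antipode n a
  b≡antipode = dH≡n⇒antipode n (<-trans a<b b<2^n) b<2^n (trans (sym dH≡) (dH-antipode n j<2^n))

  lexLt⇒ : LexLt (antipodalPair n j) (a , b) → j < a × b ≡ antipode n a
  lexLt⇒ (inj₁ j<a)          = j<a , b≡antipode
  lexLt⇒ (inj₂ (j≡a , j′<b)) = ⊥-elim (<-irrefl (trans (cong (antipode n) j≡a) (sym b≡antipode)) j′<b)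

take-applyUpTo : ∀ {A : Set} (f : ℕ → A) k m → take k (applyUpTo f m) ≡ applyUpTo f (k ⊓ m)
take-applyUpTo f zero    m       = refl
take-applyUpTo f (suc k) zero    = refl
take-applyUpTo f (suc k) (suc m) = cong (f 0 ∷_) (take-applyUpTo (λ i → f (suc i)) k m)

∈-vars-antipodalPairs⁻ : ∀ n {v} k → v ∈ vars (applyUpTo (antipodalPair n) k) →
                         ∃[ i ] i < k × (v ≡ i ⊎ v ≡ antipode n i)
∈-vars-antipodalPairs⁻ n k v∈
  with Any.applyUpTo⁻ (antipodalPair n) (∈-concatMap⁻ (λ (a , b) → a ∷ b ∷ []) v∈)
... | i , i<k , here v≡i          = i , i<k , inj₁ v≡i
... | i , i<k , there (here v≡i′) = i , i<k , inj₂ v≡i′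

∉-vars-antipodalPairs-prefix : ∀ n {j a} k → j < a → a < antipode n a →
                               a ∉ vars (take (suc j) (applyUpTo (antipodalPair n) k))
∉-vars-antipodalPairs-prefix n {j} {a} k j<a a<a′ a∈
  with i , i<1+j⊓k , a≡i∨i′ ← ∈-vars-antipodalPairs⁻ n (suc j ⊓ k)
                                (subst (λ ps → a ∈ vars ps) (take-applyUpTo _ (suc j) k) a∈)
  = a≢ (<-≤-trans i<1+j⊓k (≤-trans (m⊓n≤m (suc j) k) j<a)) a≡i∨i′
  where
  a≢ : ∀ {i} → i < a → ¬ (a ≡ i ⊎ a ≡ antipode n i)
  a≢ i<a (inj₁ a≡i)  = <-irrefl (sym a≡i) i<a
  a≢ i<a (inj₂ a≡i′) = <⇒≱ a<a′ (≤-trans (∸-monoʳ-≤ (2 ^ n ∸ 1) (<⇒≤ i<a)) (≤-reflexive (sym a≡i′)))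

antipodalPairs-admissible : ∀ {n r m} → r < n → m ≤ ⌊ 2 ^ n /2⌋ →
                            Admissible n r (applyUpTo (antipodalPair n) m)
antipodalPairs-admissible {n} {r} {m} r<n m≤⌊2^n/2⌋ =
    All.applyUpTo⁺₁ _ m (λ i<m → antipodalPair-isGen r<n (below i<m))
  , Linked.applyUpTo⁺₁ _ m (λ 1+i<m → antipodalPair-≺ n ≤-refl (<⌊2^n/2⌋⇒<2^n n (below 1+i<m)))
  , noLaterDivisor
  where
  ps : List Pair
  ps = applyUpTo (antipodalPair n) m

  below : ∀ {i} → i < m → i < ⌊ 2 ^ n /2⌋
  below i<m = <-≤-trans i<m m≤⌊2^n/2⌋

  index<2^n : (h : Fin (length ps)) → toℕ h < 2 ^ n
  index<2^n h = <⌊2^n/2⌋⇒<2^n n (below (subst (toℕ h <_) (length-applyUpTo _ m) (toℕ<n h)))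

  noLaterDivisor : (h : Fin (length ps)) (q : Pair) → IsGen n r q → lookup ps h ≺[ n ] q →
                   ¬ DividesLcm q (take (suc (toℕ h)) ps)
  noLaterDivisor h (a , b) (a<b , b<2^n , _) h≺q (a∈ , _)
    with j<a , b≡antipode ← antipodalPair-≺⇒ n (index<2^n h) a<b b<2^n
                              (subst (_≺[ n ] (a , b)) (lookup-applyUpTo _ m h) h≺q)
    = ∉-vars-antipodalPairs-prefix n m j<a (subst (a <_) b≡antipode a<b) a∈

mainTheorem6 : (n r : ℕ) → r < n → Admissible n r (Theta n)
mainTheorem6 n r r<n =
  subst (Admissible n r) (sym (map-upTo (antipodalPair n) ⌊ 2 ^ n /2⌋))
        (antipodalPairs-admissible r<n ≤-refl)
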